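{- For any monoid $M$ with unit $e$, the graded set $G_M=G_M(0)\sqcup G_M(1)\sqcup G_M(2)$ with $G_M(0)=\{\epsilon\}$, $G_M(1)=\{1^\alpha:\alpha\in M\}$, and $G_M(2)=\{1^e2^e\}$ is a generating set of the clone $\mathbf{P}(M)$.
   Context: A clone $C$ is a graded set with superposition maps $C(n)\times C(m)^n\to C(m)$ and projections $\mathbf{1}_{i,n}$ satisfying the usual clone axioms; a subset $S$ generates $C$ if the smallest subset containing $S$ and all projections and closed under superposition is $C$. For a monoid $(M,\cdot,e)$: an $M$-pigmented letter is a pair $i^\alpha$ ($i\ge1$ an integer, $\alpha\in M$); $\mathbf{P}(M)(n)$ is the set of words of $M$-pigmented letters with values in $[n]$ ($\epsilon$ the empty word, here in arity $0$). For $\alpha\in M$, $\alpha\odot i_1^{\alpha_1}\cdots i_\ell^{\alpha_\ell}:=i_1^{\alpha\cdot\alpha_1}\cdots i_\ell^{\alpha\cdot\alpha_\ell}$. The clone $\mathbf{P}(M)$ has superposition $i_1^{\alpha_1}\cdots i_\ell^{\alpha_\ell}[\mathfrak{p}_1,\dots,\mathfrak{p}_n]:=(\alpha_1\odot\mathfrak{p}_{i_1})\cdots(\alpha_\ell\odot\mathfrak{p}_{i_\ell})$ and projections $\mathbf{1}_{i,n}:=i^e$. -}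

module Defs where

open import Level using (_⊔_)
open import Algebra.Bundles using (Monoid)
open import Data.Nat using (ℕ; zero; suc)
open import Data.Fin using (Fin; zero; suc)
open import Data.List using (List; []; _∷_; map; concatMap)
open import Data.Product using (_×_; _,_)
open import Data.List.Relation.Binary.Pointwise using (Pointwise)
open import Relation.Binary.PropositionalEquality using (_≡_)

module Pigmented {c ℓ} (M : Monoid c ℓ) where
  open Monoid M

  -- an M-pigmented letter i^α with i ∈ [n] (Fin n, 0-indexed)
  Letter : ℕ → Set c
  Letter n = Fin n × Carrier

  -- P(M)(n): words of M-pigmented letters with values in [n]
  Word : ℕ → Set c
  Word n = List (Letter n)

  _≈W_ : ∀ {n} → Word n → Word n → Set (c ⊔ ℓ)
  _≈W_ = Pointwise (λ { (i , α) (j , β) → (i ≡ j) × (α ≈ β) })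

  _⊙_ : ∀ {n} → Carrier → Word n → Word n
  α ⊙ w = map (λ { (i , β) → (i , α ∙ β) }) w

  _[_] : ∀ {n m} → Word n → (Fin n → Word m) → Word m
  w [ ps ] = concatMap (λ { (i , α) → α ⊙ ps i }) w

  proj : ∀ {n} → Fin n → Word n
  proj i = (i , ε) ∷ []

  data Generated (S : ∀ n → Word n → Set c) : ∀ n → Word n → Set c where
    gen  : ∀ {n w} → S n w → Generated S n w
    prj  : ∀ {n} (i : Fin n) → Generated S n (proj i)
    comp : ∀ {n m} {w : Word n} {ps : Fin n → Word m} →
           Generated S n w → (∀ i → Generated S m (ps i)) →
           Generated S m (w [ ps ])

  Generates : (∀ n → Word n → Set c) → Set (c ⊔ ℓ)
  Generates S = ∀ n (w : Word n) →
    Data.Product.Σ (Word n) (λ w′ → Generated S n w′ × (w′ ≈W w))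

  data G : ∀ n → Word n → Set c where
    g0 : G 0 []
    g1 : (α : Carrier) → G 1 ((zero , α) ∷ [])
    g2 : G 2 ((zero , ε) ∷ (suc zero , ε) ∷ [])

{-# OPTIONS --safe #-}
-- Every word is a concatenation of one-letter words, so it suffices that ε,
-- every letter and every concatenation are generated: ε is the generator of
-- arity 0, i^α is 1^α[1_{i,n}], and u v is 1^e 2^e[u, v].  The latter two hold
-- only up to the unit laws α · e ≈ α and e · β ≈ β of M.
module Submission where

open import Defs
open import Algebra.Bundles using (Monoid)
open import Level using (_⊔_)
open import Data.Nat using (ℕ)
open import Data.Fin using (Fin; zero; suc)
open import Data.List using ([]; _∷_; _++_)
open import Data.List.Properties using (++-identityʳ)
open import Data.List.Relation.Binary.Pointwise using ([]; _∷_; ++⁺)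
open import Data.Product using (Σ; _×_; _,_)
open import Relation.Binary.PropositionalEquality using (refl; sym; subst)

module Generation {c ℓ} (M : Monoid c ℓ) where
  open Monoid M using (Carrier; ε; trans; identityˡ; identityʳ)
  open Pigmented M

  Generable : ∀ n → Word n → Set (c ⊔ ℓ)
  Generable n w = Σ (Word n) λ w′ → Generated G n w′ × (w′ ≈W w)

  ε⊙-≈W : ∀ {n} {u v : Word n} → u ≈W v → (ε ⊙ u) ≈W v
  ε⊙-≈W []                  = []
  ε⊙-≈W ((i≡j , α≈β) ∷ u≈v) = (i≡j , trans (identityˡ _) α≈β) ∷ ε⊙-≈W u≈v

  generable-[] : ∀ {n} → Generable n []
  generable-[] = [] , comp {ps = λ ()} (gen g0) (λ ()) , []

  generable-letter : ∀ {n} (i : Fin n) (α : Carrier) → Generable n ((i , α) ∷ [])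
  generable-letter i α =
    _ , comp (gen (g1 α)) (λ _ → prj i) , (refl , identityʳ α) ∷ []

  generable-++ : ∀ {n} {u v : Word n} → Generable n u → Generable n v → Generable n (u ++ v)
  generable-++ {n} {u} {v} (u′ , gen-u′ , u′≈u) (v′ , gen-v′ , v′≈v) =
    _ , comp {ps = ps} (gen g2) gen-ps , ++⁺ (ε⊙-≈W u′≈u) ε⊙v′++[]≈v
    where
    ps : Fin 2 → Word n
    ps zero       = u′
    ps (suc zero) = v′

    gen-ps : ∀ j → Generated G n (ps j)
    gen-ps zero       = gen-u′
    gen-ps (suc zero) = gen-v′

    ε⊙v′++[]≈v : ((ε ⊙ v′) ++ []) ≈W v
    ε⊙v′++[]≈v = subst (_≈W v) (sym (++-identityʳ (ε ⊙ v′))) (ε⊙-≈W v′≈v)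

  generable : ∀ n (w : Word n) → Generable n w
  generable n []             = generable-[]
  generable n ((i , α) ∷ w) = generable-++ (generable-letter i α) (generable n w)

proposition3p2p2 : ∀ {c ℓ} (M : Monoid c ℓ) → Pigmented.Generates M (Pigmented.G M)
proposition3p2p2 M = Generation.generable M
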